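{- Let $M$ be a pomonoid. Then the pomonoid $F_U(M)$ is cancellative if and only if $M$ is integrally closed. If $M$ is commutative, then the commutative pomonoid $CF_U(M)$ is cancellative if and only if $M$ is integrally closed.
   Context: A pomonoid is a monoid with a partial order for which multiplication is isotone in both arguments; it is cancellative if $ax\leq bx\Rightarrow a\leq b$ and $xa\leq xb\Rightarrow a\leq b$, and integrally closed if $ax\leq a\Rightarrow x\leq1$ and $xa\leq a\Rightarrow x\leq 1$. Construction of $F_U(M)$: let $M^*$ be the set of finite words over $M$ (including the empty word $\varepsilon$), with concatenation $\circ$; for a word $w=[a_1,\dots,a_n]$ put $\gamma(w)=a_1\cdots a_n$ and $\gamma(\varepsilon)=1$. Define a preorder $\sqsubseteq$ on $M^*$ by: $u\sqsubseteq\varepsilon$ iff $u=\varepsilon$; and $u\sqsubseteq[b_1,\dots,b_n]$ ($n\geq1$) iff $u=u_1\circ\dots\circ u_n$ for some (possibly empty) words $u_i$ with $\gamma(u_i)\leq b_i$ in $M$ for all $i$. $F_U(M)$ is the set of non-empty words modulo the equivalence $u\sim v\iff u\sqsubseteq v\sqsubseteq u$, ordered by $\sqsubseteq$, with multiplication induced by concatenation and unit the class of $[1]$. For commutative $M$, $CF_U(M)$ is defined in the same way using words up to permutation of letters (finite multisets), where $u\sqsubseteq[b_1,\dots,b_n]$ iff $u$ splits as a multiset union $u_1+\dots+u_n$ (parts possibly empty) with $\gamma(u_i)\leq b_i$. -}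

module Defs where

open import Level using (Level; _⊔_; suc)
open import Data.List using (List; []; _∷_; _++_; foldr)
open import Data.List.Relation.Binary.Permutation.Propositional using (_↭_)
open import Data.Product using (Σ; _×_; ∃)
open import Relation.Binary.PropositionalEquality using (_≡_; _≢_)
open import Relation.Binary.Structures using (IsPartialOrder)
open import Relation.Nullary using (¬_)

record Pomonoid (c ℓ : Level) : Set (suc (c ⊔ ℓ)) where
  infixl 7 _∙_
  infix 4 _≤_
  field
    Carrier        : Set c
    _≤_            : Carrier → Carrier → Set ℓ
    _∙_            : Carrier → Carrier → Carrier
    ε              : Carrier
    isPartialOrder : IsPartialOrder _≡_ _≤_
    assoc          : ∀ x y z → (x ∙ y) ∙ z ≡ x ∙ (y ∙ z)
    identityˡ      : ∀ x → ε ∙ x ≡ x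
    identityʳ      : ∀ x → x ∙ ε ≡ x
    monoˡ          : ∀ {x y} z → x ≤ y → x ∙ z ≤ y ∙ z
    monoʳ          : ∀ {x y} z → x ≤ y → z ∙ x ≤ z ∙ y

IsCommutative : ∀ {c ℓ} → Pomonoid c ℓ → Set c
IsCommutative M = ∀ x y → x ∙ y ≡ y ∙ x
  where open Pomonoid M

module _ {c ℓ} (M : Pomonoid c ℓ) where
  open Pomonoid M

  IntegrallyClosed : Set (c ⊔ ℓ)
  IntegrallyClosed = (∀ a x → a ∙ x ≤ a → x ≤ ε) × (∀ a x → x ∙ a ≤ a → x ≤ ε)

  Word : Set c
  Word = List Carrier

  γ : Word → Carrier
  γ = foldr _∙_ ε

  data _⊑_ : Word → Word → Set (c ⊔ ℓ) where
    ⊑-[] : [] ⊑ []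
    ⊑-∷  : ∀ u₁ u b bs → γ u₁ ≤ b → u ⊑ bs → (u₁ ++ u) ⊑ (b ∷ bs)

  -- commutative version (words up to permutation = finite multisets):
  -- u ⊑ᶜ [b₁,…,bₙ] iff u splits as a multiset union u₁+…+uₙ with γ(uᵢ) ≤ bᵢ
  _⊑ᶜ_ : Word → Word → Set (c ⊔ ℓ)
  u ⊑ᶜ v = ∃ λ u′ → (u ↭ u′) × (u′ ⊑ v)

  -- Cancellativity of F_U(M): elements are non-empty words (up to ⊑-equivalence),
  -- ordered by ⊑, multiplication induced by concatenation.
  FU-Cancellative : Set (c ⊔ ℓ)
  FU-Cancellative =
    ∀ (a b x : Word) → a ≢ [] → b ≢ [] → x ≢ [] →
      ((a ++ x) ⊑ (b ++ x) → a ⊑ b) × ((x ++ a) ⊑ (x ++ b) → a ⊑ b)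

  -- Cancellativity of CF_U(M): elements are non-empty multisets (represented by
  -- lists, up to ⊑ᶜ-equivalence), multiplication is multiset union.
  CFU-Cancellative : Set (c ⊔ ℓ)
  CFU-Cancellative =
    ∀ (a b x : Word) → a ≢ [] → b ≢ [] → x ≢ [] →
      ((a ++ x) ⊑ᶜ (b ++ x) → a ⊑ᶜ b) × ((x ++ a) ⊑ᶜ (x ++ b) → a ⊑ᶜ b)

{-# OPTIONS --safe #-}
-- Cancelling a common first letter x from x a ⊑ x v: the block of x a lying
-- below x is either empty, so 1 ≤ x and x can be dropped, or of the form x w with
-- x γ(w) ≤ x; integral closedness then gives γ(w) ≤ 1, and w is absorbed into the
-- first block of v.  Last letters are cancelled symmetrically.  For multisets x
-- may instead fall into a later block, where it is replaced by the first block
-- (whose value is ≤ x).  Conversely, cancelling a from a x ⊑ a 1 and from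
-- x a ⊑ 1 a yields exactly the two halves of integral closedness.
module Submission where

open import Defs
open import Level using (Level; _⊔_)
open import Data.Empty using (⊥-elim)
open import Data.Product using (_×_; _,_; ∃; ∃₂; proj₁; proj₂)
open import Data.Sum using (inj₁; inj₂)
open import Function.Base using (id; _∘′_)
open import Function.Bundles using (_⇔_; mk⇔)
open import Data.List using ([]; _∷_; _++_; [_]; _∷ʳ_)
open import Data.List.Properties using (++-assoc; ++-identityʳ; ++-conicalʳ; ∷ʳ-injective)
open import Data.List.Reverse using (reverseView; []; _∶_∶ʳ_)
open import Data.List.Relation.Unary.Any using (here)
open import Data.List.Membership.Propositional using (_∈_)
open import Data.List.Membership.Propositional.Properties using (∈-++⁻; ∈-∃++)
open import Data.List.Relation.Binary.Permutation.Propositional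
  as ↭ using (_↭_; ↭-refl; ↭-sym; ↭-trans)
open import Data.List.Relation.Binary.Permutation.Propositional.Properties
  using (++⁺ˡ; ++⁺ʳ; shift; shifts; drop-∷; ∈-resp-↭; ↭-singleton-inv)
  renaming (++-comm to ↭-++-comm)
open import Relation.Binary.PropositionalEquality
  using (_≡_; _≢_; refl; sym; trans; cong; subst; subst₂; module ≡-Reasoning)
open import Relation.Binary.Structures using (IsPartialOrder)

module WordOrder {c ℓ} (M : Pomonoid c ℓ) where
  open Pomonoid M
  open IsPartialOrder isPartialOrder using (reflexive) renaming (refl to ≤-refl; trans to ≤-trans)

  private
    _⊑′_ _⊑ᶜ′_ : Word M → Word M → Set (c ⊔ ℓ)
    _⊑′_ = _⊑_ M
    _⊑ᶜ′_ = _⊑ᶜ_ M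
    γ′ : Word M → Carrier
    γ′ = γ M
  infix 4 _⊑′_ _⊑ᶜ′_

  ∙-mono : ∀ {x y z w} → x ≤ y → z ≤ w → x ∙ z ≤ y ∙ w
  ∙-mono x≤y z≤w = ≤-trans (monoˡ _ x≤y) (monoʳ _ z≤w)

  γ-++ : ∀ u v → γ′ (u ++ v) ≡ γ′ u ∙ γ′ v
  γ-++ []      v = sym (identityˡ _)
  γ-++ (x ∷ u) v = begin
    x ∙ γ′ (u ++ v)     ≡⟨ cong (x ∙_) (γ-++ u v) ⟩
    x ∙ (γ′ u ∙ γ′ v)   ≡⟨ sym (assoc x _ _) ⟩
    (x ∙ γ′ u) ∙ γ′ v   ∎
    where open ≡-Reasoning

  ⊑-[-]⁺ : ∀ {w b} → γ′ w ≤ b → w ⊑′ [ b ]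
  ⊑-[-]⁺ {w} {b} h = subst (_⊑′ [ b ]) (++-identityʳ w) (⊑-∷ w [] b [] h ⊑-[])

  ⊑-[-]⁻ : ∀ {w b} → w ⊑′ [ b ] → γ′ w ≤ b
  ⊑-[-]⁻ (⊑-∷ w [] b [] h ⊑-[]) = subst (_≤ b) (sym (cong γ′ (++-identityʳ w))) h

  ⊑-singleton⁻ : ∀ {x y} → [ x ] ⊑′ [ y ] → x ≤ y
  ⊑-singleton⁻ {x} d = subst (_≤ _) (identityʳ x) (⊑-[-]⁻ d)

  ⊑-refl : ∀ {u} → u ⊑′ u
  ⊑-refl {[]}    = ⊑-[]
  ⊑-refl {x ∷ u} = ⊑-∷ [ x ] u x u (reflexive (identityʳ x)) ⊑-refl

  ⊑-++ : ∀ {u v u′ v′} → u ⊑′ v → u′ ⊑′ v′ → u ++ u′ ⊑′ v ++ v′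
  ⊑-++ ⊑-[] d′ = d′
  ⊑-++ {u′ = u′} {v′} (⊑-∷ u₁ u b bs h d) d′ =
    subst (_⊑′ b ∷ bs ++ v′) (sym (++-assoc u₁ u u′)) (⊑-∷ u₁ (u ++ u′) b (bs ++ v′) h (⊑-++ d d′))

  ⊑-++⁻ : ∀ v {v′ u} → u ⊑′ v ++ v′ → ∃₂ λ u₁ u₂ → u ≡ u₁ ++ u₂ × u₁ ⊑′ v × u₂ ⊑′ v′
  ⊑-++⁻ []      {u = u} d = [] , u , refl , ⊑-[] , d
  ⊑-++⁻ (b ∷ v) (⊑-∷ w₁ w b _ h d) with ⊑-++⁻ v d
  ... | u₁ , u₂ , refl , d₁ , d₂ = w₁ ++ u₁ , u₂ , sym (++-assoc w₁ u₁ u₂) , ⊑-∷ w₁ u₁ b v h d₁ , d₂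

  γ-mono : ∀ {u v} → u ⊑′ v → γ′ u ≤ γ′ v
  γ-mono ⊑-[] = ≤-refl
  γ-mono (⊑-∷ u₁ u b bs h d) = subst (_≤ _) (sym (γ-++ u₁ u)) (∙-mono h (γ-mono d))

  ⊑-trans : ∀ {u v w} → u ⊑′ v → v ⊑′ w → u ⊑′ w
  ⊑-trans u⊑v ⊑-[] = u⊑v
  ⊑-trans u⊑v (⊑-∷ v₁ v b bs h d) with ⊑-++⁻ v₁ u⊑v
  ... | u₁ , u₂ , refl , d₁ , d₂ = ⊑-∷ u₁ u₂ b bs (≤-trans (γ-mono d₁) h) (⊑-trans d₂ d)

  ε∷⊑ : ∀ {v} → v ≢ [] → ε ∷ v ⊑′ v
  ε∷⊑ {[]}     v≢[] = ⊥-elim (v≢[] refl)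
  ε∷⊑ {b ∷ bs} _    =
    ⊑-∷ (ε ∷ [ b ]) bs b bs (reflexive (trans (identityˡ _) (identityʳ b))) ⊑-refl

  ∷ʳε⊑ : ∀ {v} → v ≢ [] → v ∷ʳ ε ⊑′ v
  ∷ʳε⊑ {[]}          v≢[] = ⊥-elim (v≢[] refl)
  ∷ʳε⊑ {b ∷ []}      _    =
    ⊑-[-]⁺ (reflexive (trans (cong (b ∙_) (identityʳ ε)) (identityʳ b)))
  ∷ʳε⊑ {b ∷ b′ ∷ bs} _    = ⊑-∷ [ b ] _ b _ (reflexive (identityʳ b)) (∷ʳε⊑ (λ ()))

  ++-≢[] : ∀ u {v : Word M} → v ≢ [] → u ++ v ≢ []
  ++-≢[] u v≢[] = v≢[] ∘′ ++-conicalʳ u _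

  module _ (closed : IntegrallyClosed M) where

    ⊑-cancelˡ-∷ : ∀ {x a v} → v ≢ [] → x ∷ a ⊑′ x ∷ v → a ⊑′ v
    ⊑-cancelˡ-∷ {x} {a} v≢[] d with ⊑-++⁻ [ x ] d
    ... | [] , u , refl , ε≤x , u⊑v =
      ⊑-trans (⊑-∷ [] a x a (⊑-[-]⁻ ε≤x) ⊑-refl) u⊑v
    ... | .x ∷ w , u , refl , xw≤x , u⊑v =
      ⊑-trans (⊑-++ (⊑-[-]⁺ (proj₁ closed x (γ′ w) (⊑-[-]⁻ xw≤x))) u⊑v) (ε∷⊑ v≢[])

    ⊑-cancelʳ-∷ʳ : ∀ {x a v} → v ≢ [] → a ∷ʳ x ⊑′ v ∷ʳ x → a ⊑′ v
    ⊑-cancelʳ-∷ʳ {x} {a} {v} v≢[] d with ⊑-++⁻ v d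
    ... | u₁ , u₂ , eq , u₁⊑v , u₂⊑x with reverseView u₂
    ...   | [] with refl ← trans eq (++-identityʳ u₁) =
      ⊑-trans (subst (_⊑′ a ∷ʳ x) (++-identityʳ a) (⊑-++ ⊑-refl u₂⊑x)) u₁⊑v
    ...   | w ∶ _ ∶ʳ y with ∷ʳ-injective a (u₁ ++ w) (trans eq (sym (++-assoc u₁ w [ y ])))
    ...     | refl , refl =
      ⊑-trans (⊑-++ u₁⊑v (⊑-[-]⁺ (proj₂ closed x (γ′ w) wx≤x))) (∷ʳε⊑ v≢[])
      where
      wx≤x : γ′ w ∙ x ≤ x
      wx≤x = subst (_≤ x) (trans (γ-++ w [ x ]) (cong (γ′ w ∙_) (identityʳ x))) (⊑-[-]⁻ u₂⊑x)

    ⊑-cancelˡ : ∀ x {a v} → v ≢ [] → x ++ a ⊑′ x ++ v → a ⊑′ v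
    ⊑-cancelˡ []      v≢[] d = d
    ⊑-cancelˡ (y ∷ x) v≢[] d = ⊑-cancelˡ x v≢[] (⊑-cancelˡ-∷ (++-≢[] x v≢[]) d)

    ⊑-cancelʳ : ∀ x {a v} → v ≢ [] → a ++ x ⊑′ v ++ x → a ⊑′ v
    ⊑-cancelʳ []      {a} {v} v≢[] d = subst₂ _⊑′_ (++-identityʳ a) (++-identityʳ v) d
    ⊑-cancelʳ (y ∷ x) {a} {v} v≢[] d =
      ⊑-cancelʳ-∷ʳ v≢[] (⊑-cancelʳ x (++-≢[] v (λ ())) (subst₂ _⊑′_ (reassoc a) (reassoc v) d))
      where
      reassoc : ∀ u → u ++ y ∷ x ≡ (u ∷ʳ y) ++ x
      reassoc u = sym (++-assoc u [ y ] x)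

  ⊑⇒⊑ᶜ : ∀ {u v} → u ⊑′ v → u ⊑ᶜ′ v
  ⊑⇒⊑ᶜ d = _ , ↭-refl , d

  ⊑ᶜ-respˡ-↭ : ∀ {u u′ v} → u ↭ u′ → u′ ⊑ᶜ′ v → u ⊑ᶜ′ v
  ⊑ᶜ-respˡ-↭ p (u″ , p′ , d) = u″ , ↭-trans p p′ , d

  ⊑-respʳ-↭ : ∀ {u v v′} → u ⊑′ v → v ↭ v′ → u ⊑ᶜ′ v′
  ⊑-respʳ-↭ d ↭.refl = ⊑⇒⊑ᶜ d
  ⊑-respʳ-↭ (⊑-∷ u₁ u x _ h d) (↭.prep x p) with ⊑-respʳ-↭ d p
  ... | u′ , q , d′ = u₁ ++ u′ , ++⁺ˡ u₁ q , ⊑-∷ u₁ u′ x _ h d′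
  ⊑-respʳ-↭ (⊑-∷ u₁ _ x _ h (⊑-∷ u₂ u y _ h₂ d)) (↭.swap x y p) with ⊑-respʳ-↭ d p
  ... | u′ , q , d′ = u₂ ++ u₁ ++ u′ , ↭-trans (++⁺ˡ u₁ (++⁺ˡ u₂ q)) (shifts u₁ u₂) ,
                      ⊑-∷ u₂ (u₁ ++ u′) y _ h₂ (⊑-∷ u₁ u′ x _ h d′)
  ⊑-respʳ-↭ d (↭.trans p q) with ⊑-respʳ-↭ d p
  ... | u′ , p′ , d′ = ⊑ᶜ-respˡ-↭ p′ (⊑-respʳ-↭ d′ q)

  ⊑ᶜ-respʳ-↭ : ∀ {u v v′} → u ⊑ᶜ′ v → v ↭ v′ → u ⊑ᶜ′ v′
  ⊑ᶜ-respʳ-↭ (u′ , p , d) q = ⊑ᶜ-respˡ-↭ p (⊑-respʳ-↭ d q)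

  ⊑ᶜ-trans : ∀ {u v w} → u ⊑ᶜ′ v → v ⊑ᶜ′ w → u ⊑ᶜ′ w
  ⊑ᶜ-trans (u′ , p , u′⊑v) (v′ , q , v′⊑w) with ⊑-respʳ-↭ u′⊑v q
  ... | u″ , p′ , u″⊑v′ = u″ , ↭-trans p p′ , ⊑-trans u″⊑v′ v′⊑w

  ⊑ᶜ-singleton⁻ : ∀ {x y} → [ x ] ⊑ᶜ′ [ y ] → x ≤ y
  ⊑ᶜ-singleton⁻ (u , p , d) with refl ← ↭-singleton-inv (↭-sym p) = ⊑-singleton⁻ d

  ∈⇒↭∷ : ∀ {x : Carrier} {u} → x ∈ u → ∃ λ r → u ↭ x ∷ r
  ∈⇒↭∷ x∈u with p , q , refl ← ∈-∃++ x∈u = p ++ q , shift _ p q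

  module _ (comm : IsCommutative M) where

    γ-↭ : ∀ {u v} → u ↭ v → γ′ u ≡ γ′ v
    γ-↭ ↭.refl = refl
    γ-↭ (↭.prep x p) = cong (x ∙_) (γ-↭ p)
    γ-↭ (↭.swap {u} {v} x y p) = begin
      x ∙ (y ∙ γ′ u)   ≡⟨ cong (λ z → x ∙ (y ∙ z)) (γ-↭ p) ⟩
      x ∙ (y ∙ γ′ v)   ≡⟨ sym (assoc x y _) ⟩
      (x ∙ y) ∙ γ′ v   ≡⟨ cong (_∙ γ′ v) (comm x y) ⟩
      (y ∙ x) ∙ γ′ v   ≡⟨ assoc y x _ ⟩
      y ∙ (x ∙ γ′ v)   ∎
      where open ≡-Reasoning
    γ-↭ (↭.trans p q) = trans (γ-↭ p) (γ-↭ q)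

    module _ (closed : IntegrallyClosed M) where

      ⊑ᶜ-cancelˡ-∷ : ∀ {x a v} → v ≢ [] → x ∷ a ⊑ᶜ′ x ∷ v → a ⊑ᶜ′ v
      ⊑ᶜ-cancelˡ-∷ {x} {a} v≢[] (_ , p , d) with ⊑-++⁻ [ x ] d
      ... | u₁ , u₂ , refl , u₁⊑x , u₂⊑v with ∈-++⁻ u₁ (∈-resp-↭ p (here refl))
      ...   | inj₁ x∈u₁ with w , u₁↭xw ← ∈⇒↭∷ x∈u₁ =
        w ++ u₂ , drop-∷ (↭-trans p (++⁺ʳ u₂ u₁↭xw)) ,
        ⊑-trans (⊑-++ (⊑-[-]⁺ (proj₁ closed x (γ′ w) xw≤x)) u₂⊑v) (ε∷⊑ v≢[])
        where
        xw≤x : x ∙ γ′ w ≤ x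
        xw≤x = subst (_≤ x) (γ-↭ u₁↭xw) (⊑-[-]⁻ u₁⊑x)
      ...   | inj₂ x∈u₂ with r , u₂↭xr ← ∈⇒↭∷ x∈u₂ =
        ⊑ᶜ-respˡ-↭ (drop-∷ a↭) (⊑ᶜ-trans (⊑⇒⊑ᶜ (⊑-++ u₁⊑x ⊑-refl)) (_ , ↭-sym u₂↭xr , u₂⊑v))
        where
        a↭ : x ∷ a ↭ x ∷ u₁ ++ r
        a↭ = ↭-trans p (↭-trans (++⁺ˡ u₁ u₂↭xr) (shift x u₁ r))

      ⊑ᶜ-cancelˡ : ∀ x {a v} → v ≢ [] → x ++ a ⊑ᶜ′ x ++ v → a ⊑ᶜ′ v
      ⊑ᶜ-cancelˡ []      v≢[] d = d
      ⊑ᶜ-cancelˡ (y ∷ x) v≢[] d = ⊑ᶜ-cancelˡ x v≢[] (⊑ᶜ-cancelˡ-∷ (++-≢[] x v≢[]) d)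

      ⊑ᶜ-cancelʳ : ∀ x {a v} → v ≢ [] → a ++ x ⊑ᶜ′ v ++ x → a ⊑ᶜ′ v
      ⊑ᶜ-cancelʳ x {a} {v} v≢[] d =
        ⊑ᶜ-cancelˡ x v≢[] (⊑ᶜ-respˡ-↭ (↭-++-comm x a) (⊑ᶜ-respʳ-↭ d (↭-++-comm v x)))

  -- FU-Cancellative M and CFU-Cancellative M unfold to this, for _⊑_ M and _⊑ᶜ_ M.
  Cancellative : (Word M → Word M → Set (c ⊔ ℓ)) → Set (c ⊔ ℓ)
  Cancellative _≼_ =
    ∀ (a b x : Word M) → a ≢ [] → b ≢ [] → x ≢ [] →
      ((a ++ x) ≼ (b ++ x) → a ≼ b) × ((x ++ a) ≼ (x ++ b) → a ≼ b)

  integrallyClosed⇒⊑-cancellative : IntegrallyClosed M → Cancellative _⊑′_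
  integrallyClosed⇒⊑-cancellative closed _ _ x _ b≢[] _ =
    ⊑-cancelʳ closed x b≢[] , ⊑-cancelˡ closed x b≢[]

  integrallyClosed⇒⊑ᶜ-cancellative : IsCommutative M → IntegrallyClosed M → Cancellative _⊑ᶜ′_
  integrallyClosed⇒⊑ᶜ-cancellative comm closed _ _ x _ b≢[] _ =
    ⊑ᶜ-cancelʳ comm closed x b≢[] , ⊑ᶜ-cancelˡ comm closed x b≢[]

  cancellative⇒integrallyClosed :
    ∀ {_≼_} → (∀ {u v} → u ⊑′ v → u ≼ v) → (∀ {x y} → [ x ] ≼ [ y ] → x ≤ y) →
    Cancellative _≼_ → IntegrallyClosed M
  cancellative⇒integrallyClosed {_≼_} ⊑⇒≼ ≼-singleton⁻ cancel = closedʳ , closedˡ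
    where
    cancelSingletons : ∀ a x →
      ((x ∷ [ a ]) ≼ (ε ∷ [ a ]) → [ x ] ≼ [ ε ]) × ((a ∷ [ x ]) ≼ (a ∷ [ ε ]) → [ x ] ≼ [ ε ])
    cancelSingletons a x = cancel [ x ] [ ε ] [ a ] (λ ()) (λ ()) (λ ())

    twoBlocks : ∀ u v {b d} → γ′ u ≤ b → γ′ v ≤ d → u ++ v ⊑′ b ∷ [ d ]
    twoBlocks u v h h′ = ⊑-++ (⊑-[-]⁺ {u} h) (⊑-[-]⁺ {v} h′)

    γ-pair : ∀ x y → γ′ (x ∷ [ y ]) ≡ x ∙ y
    γ-pair x y = cong (x ∙_) (identityʳ y)

    closedʳ : ∀ a x → a ∙ x ≤ a → x ≤ ε
    closedʳ a x ax≤a = ≼-singleton⁻ (proj₂ (cancelSingletons a x)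
      (⊑⇒≼ (twoBlocks (a ∷ [ x ]) [] (subst (_≤ a) (sym (γ-pair a x)) ax≤a) ≤-refl)))

    closedˡ : ∀ a x → x ∙ a ≤ a → x ≤ ε
    closedˡ a x xa≤a = ≼-singleton⁻ (proj₁ (cancelSingletons a x)
      (⊑⇒≼ (twoBlocks [] (x ∷ [ a ]) ≤-refl (subst (_≤ a) (sym (γ-pair x a)) xa≤a))))

mainTheorem11 : ∀ {c ℓ : Level} (M : Pomonoid c ℓ) →
    (FU-Cancellative M ⇔ IntegrallyClosed M) ×
    (IsCommutative M → (CFU-Cancellative M ⇔ IntegrallyClosed M))
mainTheorem11 M =
  mk⇔ (cancellative⇒integrallyClosed id ⊑-singleton⁻) integrallyClosed⇒⊑-cancellative ,
  λ comm → mk⇔ (cancellative⇒integrallyClosed ⊑⇒⊑ᶜ ⊑ᶜ-singleton⁻)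
                (integrallyClosed⇒⊑ᶜ-cancellative comm)
  where open WordOrder M
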